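{- Let $H$ be a graph and let $k$ be its degeneracy. Then $$AR(H) \leq k\, e(H) - k + v(H).$$
   Context: All graphs are finite and simple; $v(H)$ and $e(H)$ denote the numbers of vertices and edges of $H$. A proper edge colouring assigns colours to edges so that edges sharing a vertex receive distinct colours. A copy of $H$ in an edge-coloured graph is rainbow if all its edges have distinct colours. The local anti-Ramsey number $AR(H)$ is the smallest integer $n$ such that every proper edge colouring of the complete graph $K_n$ contains a rainbow copy of $H$. The degeneracy of a graph $H$ is the smallest integer $d$ for which there is an ordering $v_1,\dots,v_n$ of $V(H)$ such that $|\{1 \le j < i : v_jv_i \in E(H)\}| \le d$ for every $1 \le i \le n$. -}

module Defs where

open import Data.Nat using (ℕ; _≤_; _<ᵇ_; _+_; _*_; _∸_)
open import Data.Bool using (Bool; T; _∧_)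
open import Data.Empty using (⊥)
open import Data.Fin using (Fin; toℕ)
open import Data.Fin.Permutation using (Permutation′; _⟨$⟩ʳ_)
open import Data.List using (List; length; map; filterᵇ; allFin)
open import Data.Nat.ListAction using (sum)
open import Data.Product using (Σ; _×_; _,_)
open import Data.Sum using (_⊎_)
open import Relation.Binary.PropositionalEquality using (_≡_; _≢_)
open import Function.Definitions using (Injective)

record Graph : Set where
  field
    v       : ℕ
    adj     : Fin v → Fin v → Bool
    adj-sym : ∀ i j → adj i j ≡ adj j i
    adj-irr : ∀ i → T (adj i i) → ⊥

open Graph public

vH : Graph → ℕ
vH H = v H

eH : Graph → ℕ
eH H = sum (map (λ i → length (filterᵇ (λ j → (toℕ i <ᵇ toℕ j) ∧ adj H i j) (allFin (v H)))) (allFin (v H)))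

-- For an ordering σ (v_i = σ i), the number of earlier neighbours of v_i:
-- |{ j < i : v_j v_i ∈ E(H) }|.
backDegree : (H : Graph) → Permutation′ (v H) → Fin (v H) → ℕ
backDegree H σ i = length (filterᵇ (λ j → (toℕ j <ᵇ toℕ i) ∧ adj H (σ ⟨$⟩ʳ j) (σ ⟨$⟩ʳ i)) (allFin (v H)))

HasDegOrdering : Graph → ℕ → Set
HasDegOrdering H d = Σ (Permutation′ (v H)) λ σ → ∀ i → backDegree H σ i ≤ d

IsDegeneracy : Graph → ℕ → Set
IsDegeneracy H k = HasDegOrdering H k × (∀ d → HasDegOrdering H d → k ≤ d)

-- An edge colouring of K_n (colours in ℕ): the colour of edge ij is c i j,
-- symmetric on distinct pairs.  (Values c i i are irrelevant.)
-- Proper: two distinct edges sharing a vertex get distinct colours.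
IsProperColouring : (n : ℕ) → (Fin n → Fin n → ℕ) → Set
IsProperColouring n c =
  (∀ i j → i ≢ j → c i j ≡ c j i) ×
  (∀ i j l → i ≢ j → i ≢ l → j ≢ l → c i j ≢ c i l)

RainbowCopy : (H : Graph) (n : ℕ) → (Fin n → Fin n → ℕ) → Set
RainbowCopy H n c =
  Σ (Fin (v H) → Fin n) λ f → Injective _≡_ _≡_ f ×
    (∀ a b a' b' → T (adj H a b) → T (adj H a' b') →
       c (f a) (f b) ≡ c (f a') (f b') →
       (a ≡ a' × b ≡ b') ⊎ (a ≡ b' × b ≡ a'))

RainbowForcing : Graph → ℕ → Set
RainbowForcing H n = ∀ (c : Fin n → Fin n → ℕ) → IsProperColouring n c → RainbowCopy H n c

-- AR(H) ≤ m : the least n with RainbowForcing H n exists and is ≤ m,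
-- i.e. some n ≤ m has the property.
ARle : Graph → ℕ → Set
ARle H m = Σ ℕ λ n → n ≤ m × RainbowForcing H n

module Submission where

-- Relabel H along an ordering in which every vertex has at most k earlier
-- neighbours, put N = k·e(H) − k + v(H), and fix a proper colouring c of K_N.
-- The vertices are embedded greedily in this order, keeping the embedded part
-- injective and rainbow.  To place the i-th vertex P, let E be the edges among
-- the first i vertices, U their colours, and B the earlier neighbours of P.
-- A host vertex x is forbidden if it is already used (at most i vertices) or
-- if c(g u, x) ∈ U for some u ∈ B; as c is proper, each u forbids at most
-- |U| = |E| vertices.  Since |E| + |B| ≤ e(H) and |B| ≤ k, at most
-- i + |B|·|E| ≤ i + k·(e(H) − 1) < N vertices are forbidden, so a free x
-- exists, and the new edges u x receive new and pairwise distinct colours.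

open import Defs
open import Data.Nat using (ℕ; zero; suc; _+_; _*_; _∸_; _≤_; _<_; z≤n; s≤s; _<ᵇ_)
open import Data.Nat.Properties
  using (≤-refl; ≤-trans; ≤-reflexive; ≤-<-trans; <⇒≱; ≮⇒≥; ≤∧≢⇒<; <-asym; <-irrefl;
         +-comm; +-identityʳ; n≤1+n; <-trans; +-monoʳ-≤; +-mono-≤; +-mono-<-≤; *-monoˡ-≤; *-monoʳ-≤;
         *-identityʳ; *-distribˡ-∸; m≤n+m; m+n≤o⇒m≤o∸n; m<1+n⇒m<n∨m≡n; <ᵇ⇒<; <⇒<ᵇ; module ≤-Reasoning)
  renaming (_<?_ to _<ℕ?_; _≟_ to _≟ℕ_)
open import Data.Bool using (Bool; T; _∧_)
open import Data.Bool.Properties using (T-∧)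
open import Data.Empty using (⊥-elim)
open import Data.Fin using (Fin; toℕ; fromℕ<; inject≤)
open import Data.Fin.Properties using (_≟_; toℕ-injective; toℕ-fromℕ<; toℕ<n; ¬∀⟶∃¬)
open import Data.Fin.Permutation using (Permutation′; flip; _⟨$⟩ʳ_; _⟨$⟩ˡ_; inverseˡ; inverseʳ)
open import Data.List using (List; []; _∷_; _++_; length; map; filter; filterᵇ; concatMap; allFin; upTo; cartesianProduct)
open import Data.Nat.ListAction using (sum)
open import Data.List.Properties using (length-++; length-++-sucʳ; length-map; length-upTo; length-tabulate)
open import Data.List.Membership.Propositional using (_∈_; _∉_)
open import Data.List.Membership.Propositional.Properties
  using (∈-++⁻; ∈-++⁺ˡ; ∈-++⁺ʳ; ∈-∃++; ∈-map⁺; ∈-map⁻; ∈-concatMap⁺; ∈-filter⁺; ∈-filter⁻;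
         ∈-allFin; ∈-upTo⁺; ∈-cartesianProduct⁺)
open import Data.List.Relation.Unary.Any as Any using (here; there)
open import Data.List.Relation.Unary.All as All using ()
open import Data.List.Relation.Unary.AllPairs using (_∷_)
open import Data.List.Relation.Unary.Unique.Propositional using (Unique)
import Data.List.Relation.Unary.Unique.Propositional.Properties as Unique
open import Data.List.Relation.Binary.Disjoint.Propositional using (Disjoint)
open import Data.Product using (∃; _×_; _,_; proj₁; proj₂)
open import Data.Sum using (_⊎_; inj₁; inj₂)
open import Function using (_∘_; id)
open import Function.Bundles using (Equivalence)
open import Function.Definitions using (Injective)
open import Relation.Binary.PropositionalEquality using (_≡_; _≢_; refl; sym; trans; cong; cong₂; subst; subst₂; ≢-sym; module ≡-Reasoning)
open import Relation.Nullary using (¬_; Dec; yes; no; ¬?)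
open import Relation.Nullary.Decidable using (T?; _×-dec_)

SameEdge : {A : Set} → A → A → A → A → Set
SameEdge a b a' b' = (a ≡ a' × b ≡ b') ⊎ (a ≡ b' × b ≡ a')

same-edge-trans : {A : Set} {a b a' b' p q : A} →
  SameEdge a b p q → SameEdge a' b' p q → SameEdge a b a' b'
same-edge-trans (inj₁ (refl , refl)) (inj₁ (refl , refl)) = inj₁ (refl , refl)
same-edge-trans (inj₁ (refl , refl)) (inj₂ (refl , refl)) = inj₂ (refl , refl)
same-edge-trans (inj₂ (refl , refl)) (inj₁ (refl , refl)) = inj₂ (refl , refl)
same-edge-trans (inj₂ (refl , refl)) (inj₂ (refl , refl)) = inj₁ (refl , refl)

same-edge-map : {A B : Set} (f : A → B) {a b a' b' : A} →
  SameEdge a b a' b' → SameEdge (f a) (f b) (f a') (f b')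
same-edge-map f (inj₁ (e₁ , e₂)) = inj₁ (cong f e₁ , cong f e₂)
same-edge-map f (inj₂ (e₁ , e₂)) = inj₂ (cong f e₁ , cong f e₂)

same-edge-injective : {A B : Set} {f : A → B} → Injective _≡_ _≡_ f →
  {a b a' b' : A} → SameEdge (f a) (f b) (f a') (f b') → SameEdge a b a' b'
same-edge-injective f-inj (inj₁ (e₁ , e₂)) = inj₁ (f-inj e₁ , f-inj e₂)
same-edge-injective f-inj (inj₂ (e₁ , e₂)) = inj₂ (f-inj e₁ , f-inj e₂)

increasing-same-edge : ∀ {m} {p q p' q' : Fin m} → toℕ p < toℕ q → toℕ p' < toℕ q' →
  SameEdge p q p' q' → p ≡ p' × q ≡ q'
increasing-same-edge _ _ (inj₁ same) = same
increasing-same-edge p<q p'<q' (inj₂ (refl , refl)) = ⊥-elim (<-asym p<q p'<q')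

sortPair : ∀ {m} → Fin m → Fin m → Fin m × Fin m
sortPair a b with toℕ a <ℕ? toℕ b
... | yes _ = a , b
... | no  _ = b , a

sortPair-same : ∀ {m} (a b : Fin m) → SameEdge a b (proj₁ (sortPair a b)) (proj₂ (sortPair a b))
sortPair-same a b with toℕ a <ℕ? toℕ b
... | yes _ = inj₁ (refl , refl)
... | no  _ = inj₂ (refl , refl)

sortPair-increasing : ∀ {m} {a b : Fin m} → a ≢ b → toℕ (proj₁ (sortPair a b)) < toℕ (proj₂ (sortPair a b))
sortPair-increasing {a = a} {b} a≢b with toℕ a <ℕ? toℕ b
... | yes a<b = a<b
... | no  a≮b = ≤∧≢⇒< (≮⇒≥ a≮b) (λ b≡a → a≢b (toℕ-injective (sym b≡a)))

adj-same-edge : (G : Graph) {a b p q : Fin (v G)} → SameEdge a b p q → T (adj G a b) → T (adj G p q)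
adj-same-edge G (inj₁ (refl , refl)) ab = ab
adj-same-edge G (inj₂ (refl , refl)) ab = subst T (adj-sym G _ _) ab

adj-≢ : (G : Graph) {a b : Fin (v G)} → T (adj G a b) → a ≢ b
adj-≢ G ab refl = adj-irr G _ ab

IncreasingEdge : (G : Graph) → Fin (v G) × Fin (v G) → Set
IncreasingEdge G pq = toℕ (proj₁ pq) < toℕ (proj₂ pq) × T (adj G (proj₁ pq) (proj₂ pq))

sortPair-edge : (G : Graph) {a b : Fin (v G)} → T (adj G a b) → IncreasingEdge G (sortPair a b)
sortPair-edge G ab = sortPair-increasing (adj-≢ G ab) , adj-same-edge G (sortPair-same _ _) ab

∈-remove : {A : Set} {z w : A} (as : List A) {bs : List A} → z ∈ as ++ w ∷ bs → z ≢ w → z ∈ as ++ bs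
∈-remove as z∈ z≢w with ∈-++⁻ as z∈
... | inj₁ z∈as          = ∈-++⁺ˡ z∈as
... | inj₂ (here z≡w)    = ⊥-elim (z≢w z≡w)
... | inj₂ (there z∈bs)  = ∈-++⁺ʳ as z∈bs

injection-length : {A B : Set} (f : A → B) {xs : List A} {ys : List B} → Unique xs →
  (∀ {x y} → x ∈ xs → y ∈ xs → f x ≡ f y → x ≡ y) → (∀ {x} → x ∈ xs → f x ∈ ys) →
  length xs ≤ length ys
injection-length f {[]} _ _ _ = z≤n
injection-length f {x ∷ xs} (x∉xs ∷ unique) f-inj into with ∈-∃++ (into (here refl))
... | as , bs , refl = begin
  suc (length xs)         ≤⟨ s≤s (injection-length f unique (λ y∈ z∈ → f-inj (there y∈) (there z∈)) into-rest) ⟩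
  suc (length (as ++ bs)) ≡⟨ length-++-sucʳ as (f x) bs ⟨
  length (as ++ f x ∷ bs) ∎
  where
  open ≤-Reasoning
  into-rest : ∀ {y} → y ∈ xs → f y ∈ as ++ bs
  into-rest y∈xs = ∈-remove as (into (there y∈xs))
    (λ fy≡fx → All.lookup x∉xs y∈xs (sym (f-inj (there y∈xs) (here refl) fy≡fx)))

fresh : ∀ {N} (L : List (Fin N)) → length L < N → ∃ λ x → x ∉ L
fresh {N} L short = ¬∀⟶∃¬ N (_∈ L) (λ x → Any.any? (x ≟_) L) not-covering
  where
  not-covering : ¬ (∀ x → x ∈ L)
  not-covering covers = <⇒≱ short (subst (_≤ length L) (length-tabulate id)
    (injection-length id (Unique.allFin⁺ N) (λ _ _ x≡y → x≡y) (λ {x} _ → covers x)))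

length-concatMap-≤ : {A B : Set} (f : A → List B) {m : ℕ} (xs : List A) →
  (∀ x → length (f x) ≤ m) → length (concatMap f xs) ≤ length xs * m
length-concatMap-≤ f [] _ = z≤n
length-concatMap-≤ f {m} (x ∷ xs) bound = begin
  length (f x ++ concatMap f xs)         ≡⟨ length-++ (f x) ⟩
  length (f x) + length (concatMap f xs) ≤⟨ +-mono-≤ (bound x) (length-concatMap-≤ f xs bound) ⟩
  m + length xs * m                      ∎
  where open ≤-Reasoning

edgeRow : (H : Graph) → Fin (v H) → List (Fin (v H))
edgeRow H a = filterᵇ (λ b → (toℕ a <ᵇ toℕ b) ∧ adj H a b) (allFin (v H))

edgeList : (H : Graph) → List (Fin (v H) × Fin (v H))
edgeList H = concatMap (λ a → map (a ,_) (edgeRow H a)) (allFin (v H))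

length-edgeList : (H : Graph) → length (edgeList H) ≡ eH H
length-edgeList H = rows (allFin (v H))
  where
  rows : ∀ as → length (concatMap (λ a → map (a ,_) (edgeRow H a)) as) ≡ sum (map (length ∘ edgeRow H) as)
  rows [] = refl
  rows (a ∷ as) = trans (length-++ (map (a ,_) (edgeRow H a)))
                        (cong₂ _+_ (length-map (a ,_) (edgeRow H a)) (rows as))

∈-edgeList : (H : Graph) {ab : Fin (v H) × Fin (v H)} → IncreasingEdge H ab → ab ∈ edgeList H
∈-edgeList H {a , b} (a<b , ab) = ∈-concatMap⁺ (λ a → map (a ,_) (edgeRow H a)) (Any.map (λ { refl → b∈row }) (∈-allFin a))
  where
  b∈row : (a , b) ∈ map (a ,_) (edgeRow H a)
  b∈row = ∈-map⁺ (a ,_) (∈-filter⁺ (T? ∘ _) (∈-allFin b) (Equivalence.from T-∧ (<⇒<ᵇ a<b , ab)))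

induced : (H : Graph) {m : ℕ} → (Fin m → Fin (v H)) → Graph
induced H {m} s = record
  { v       = m
  ; adj     = λ p q → adj H (s p) (s q)
  ; adj-sym = λ p q → adj-sym H (s p) (s q)
  ; adj-irr = λ p → adj-irr H (s p)
  }

EdgeBound : Graph → ℕ → Set
EdgeBound G e = (L : List (Fin (v G) × Fin (v G))) → Unique L →
  (∀ {pq} → pq ∈ L → IncreasingEdge G pq) → length L ≤ e

-- Pulling back along an injection does not create edges: sorting the image of
-- an increasing edge maps such lists injectively into the edge list of H.
induced-edge-bound : (H : Graph) {m : ℕ} (s : Fin m → Fin (v H)) → Injective _≡_ _≡_ s →
  EdgeBound (induced H s) (eH H)
induced-edge-bound H {m} s s-inj L unique edges = begin
  length L            ≤⟨ injection-length image unique image-injective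
                           (λ pq∈L → ∈-edgeList H (sortPair-edge H (proj₂ (edges pq∈L)))) ⟩
  length (edgeList H) ≡⟨ length-edgeList H ⟩
  eH H                ∎
  where
  open ≤-Reasoning
  image : Fin m × Fin m → Fin (v H) × Fin (v H)
  image (p , q) = sortPair (s p) (s q)

  image-injective : ∀ {pq pq'} → pq ∈ L → pq' ∈ L → image pq ≡ image pq' → pq ≡ pq'
  image-injective {p , q} {p' , q'} pq∈L pq'∈L same
    with increasing-same-edge (proj₁ (edges pq∈L)) (proj₁ (edges pq'∈L))
           (same-edge-injective s-inj (same-edge-trans (sortPair-same (s p) (s q))
             (subst (λ st → SameEdge (s p') (s q') (proj₁ st) (proj₂ st)) (sym same) (sortPair-same (s p') (s q')))))
  ... | p≡p' , q≡q' = cong₂ _,_ p≡p' q≡q'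

-- The arithmetic budget: with i < n placed vertices, b ≤ k earlier neighbours
-- of the next vertex and m old edges, where m + b ≤ e, the i + b·m forbidden
-- host vertices are fewer than k·e − k + n.  For b > 0 this uses m ≤ e − 1.
budget : ∀ {i n b k m e} → i < n → b ≤ k → m + b ≤ e → i + b * m < k * e ∸ k + n
budget {i} {n} {zero} {k} i<n _ _ =
  ≤-trans (subst (_< n) (sym (+-identityʳ i)) i<n) (m≤n+m n (k * _ ∸ k))
budget {i} {n} {suc d} {k} {m} {e} i<n b≤k m+b≤e =
  subst (i + suc d * m <_) (+-comm n (k * e ∸ k)) (+-mono-<-≤ i<n bm≤)
  where
  m≤e∸1 : m ≤ e ∸ 1
  m≤e∸1 = m+n≤o⇒m≤o∸n m (≤-trans (+-monoʳ-≤ m (s≤s z≤n)) m+b≤e)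
  bm≤ : suc d * m ≤ k * e ∸ k
  bm≤ = begin
    suc d * m   ≤⟨ *-monoˡ-≤ m b≤k ⟩
    k * m       ≤⟨ *-monoʳ-≤ k m≤e∸1 ⟩
    k * (e ∸ 1) ≡⟨ *-distribˡ-∸ k e 1 ⟩
    k * e ∸ k * 1 ≡⟨ cong (k * e ∸_) (*-identityʳ k) ⟩
    k * e ∸ k   ∎
    where open ≤-Reasoning

earlierNeighbours : (G : Graph) → Fin (v G) → List (Fin (v G))
earlierNeighbours G i = filterᵇ (λ j → (toℕ j <ᵇ toℕ i) ∧ adj G j i) (allFin (v G))

module Greedy (G : Graph) (k e : ℕ)
              (degenerate : ∀ i → length (earlierNeighbours G i) ≤ k)
              (edge-bound : EdgeBound G e)
              (c : Fin (k * e ∸ k + v G) → Fin (k * e ∸ k + v G) → ℕ)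
              (proper : IsProperColouring (k * e ∸ k + v G) c) where

  n N : ℕ
  n = v G
  N = k * e ∸ k + v G

  symmetric : ∀ x y → x ≢ y → c x y ≡ c y x
  symmetric = proj₁ proper

  distinct-at : ∀ x y z → x ≢ y → x ≢ z → y ≢ z → c x y ≢ c x z
  distinct-at = proj₂ proper

  colour-same-edge : ∀ {a b p q : Fin N} → SameEdge a b p q → a ≢ b → c a b ≡ c p q
  colour-same-edge (inj₁ (refl , refl)) _   = refl
  colour-same-edge (inj₂ (refl , refl)) a≢b = symmetric _ _ a≢b

  record PartialRainbow (i : ℕ) : Set where
    field
      embed     : Fin n → Fin N
      injective : ∀ {p q} → toℕ p < i → toℕ q < i → embed p ≡ embed q → p ≡ q
      rainbow   : ∀ {p q p' q'} → toℕ q < i → toℕ q' < i →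
                  IncreasingEdge G (p , q) → IncreasingEdge G (p' , q') →
                  c (embed p) (embed q) ≡ c (embed p') (embed q') → p ≡ p' × q ≡ q'

  start : PartialRainbow 0
  start = record
    { embed     = λ p → inject≤ p (m≤n+m n (k * e ∸ k))
    ; injective = λ ()
    ; rainbow   = λ ()
    }

  complete : PartialRainbow n → RainbowCopy G N c
  complete φ = embed , (λ same → injective (toℕ<n _) (toℕ<n _) same) , rainbow-any
    where
    open PartialRainbow φ

    sorted-colour : ∀ {a b} → T (adj G a b) →
      c (embed a) (embed b) ≡ c (embed (proj₁ (sortPair a b))) (embed (proj₂ (sortPair a b)))
    sorted-colour {a} {b} ab = colour-same-edge (same-edge-map embed (sortPair-same a b))
      (λ same → adj-≢ G ab (injective (toℕ<n a) (toℕ<n b) same))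

    -- Compare two edges through their increasing listings.
    rainbow-any : ∀ a b a' b' → T (adj G a b) → T (adj G a' b') →
      c (embed a) (embed b) ≡ c (embed a') (embed b') → SameEdge a b a' b'
    rainbow-any a b a' b' ab a'b' same
      with rainbow (toℕ<n _) (toℕ<n _) (sortPair-edge G ab) (sortPair-edge G a'b')
                   (trans (sym (sorted-colour ab)) (trans same (sorted-colour a'b')))
    ... | p≡p' , q≡q' = same-edge-trans (sortPair-same a b)
            (subst₂ (SameEdge a' b') (sym p≡p') (sym q≡q') (sortPair-same a' b'))

  module Extend {i : ℕ} (i<n : i < n) (φ : PartialRainbow i) where
    open PartialRainbow φ renaming (embed to g)

    P : Fin n
    P = fromℕ< i<n

    toℕ-P : toℕ P ≡ i
    toℕ-P = toℕ-fromℕ< i<n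

    before-P : ∀ {u : Fin n} → toℕ u < toℕ P → toℕ u < i
    before-P {u} = subst (toℕ u <_) toℕ-P

    placed-or-P : ∀ {q} → toℕ q < suc i → toℕ q < i ⊎ q ≡ P
    placed-or-P q≤i with m<1+n⇒m<n∨m≡n q≤i
    ... | inj₁ q<i = inj₁ q<i
    ... | inj₂ q≡i = inj₂ (toℕ-injective (trans q≡i (sym toℕ-P)))

    placed : List (Fin n)
    placed = filter (λ p → toℕ p <ℕ? i) (allFin n)

    OldEdge : Fin n × Fin n → Set
    OldEdge pq = IncreasingEdge G pq × toℕ (proj₂ pq) < i

    old-edge? : (pq : Fin n × Fin n) → Dec (OldEdge pq)
    old-edge? (p , q) = ((toℕ p <ℕ? toℕ q) ×-dec T? (adj G p q)) ×-dec (toℕ q <ℕ? i)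

    oldEdges : List (Fin n × Fin n)
    oldEdges = filter old-edge? (cartesianProduct (allFin n) (allFin n))

    colourOf : Fin n × Fin n → ℕ
    colourOf (p , q) = c (g p) (g q)

    usedColours : List ℕ
    usedColours = map colourOf oldEdges

    old-colour-used : ∀ {p q} → toℕ q < i → IncreasingEdge G (p , q) → c (g p) (g q) ∈ usedColours
    old-colour-used q<i pq = ∈-map⁺ colourOf
      (∈-filter⁺ old-edge? (∈-cartesianProduct⁺ (∈-allFin _) (∈-allFin _)) (pq , q<i))

    isBack : Fin n → Bool
    isBack u = (toℕ u <ᵇ toℕ P) ∧ adj G u P

    back : List (Fin n)
    back = filterᵇ isBack (allFin n)

    back-edge : ∀ {u} → u ∈ back → IncreasingEdge G (u , P)
    back-edge {u} u∈ with Equivalence.to T-∧ (proj₂ (∈-filter⁻ (T? ∘ isBack) {xs = allFin n} u∈))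
    ... | u<P , uP = <ᵇ⇒< (toℕ u) (toℕ P) u<P , uP

    ∈-back : ∀ {u} → IncreasingEdge G (u , P) → u ∈ back
    ∈-back (u<P , uP) = ∈-filter⁺ (T? ∘ isBack) (∈-allFin _) (Equivalence.from T-∧ (<⇒<ᵇ u<P , uP))

    -- The host vertices x ≠ g u with c(g u, x) already used: an edge u x would repeat a colour.
    Blocked : Fin n → Fin N → Set
    Blocked u y = y ≢ g u × c (g u) y ∈ usedColours

    blocked? : ∀ u y → Dec (Blocked u y)
    blocked? u y = ¬? (y ≟ g u) ×-dec Any.any? (c (g u) y ≟ℕ_) usedColours

    blocked : Fin n → List (Fin N)
    blocked u = filter (blocked? u) (allFin N)

    forbidden : List (Fin N)
    forbidden = map g placed ++ concatMap blocked back

    -- toℕ maps the placed vertices injectively into upTo i.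
    placed-length : length placed ≤ i
    placed-length = subst (length placed ≤_) (length-upTo i)
      (injection-length toℕ (Unique.filter⁺ (λ p → toℕ p <ℕ? i) (Unique.allFin⁺ n)) (λ _ _ → toℕ-injective)
        (λ p∈ → ∈-upTo⁺ (proj₂ (∈-filter⁻ (λ p → toℕ p <ℕ? i) {xs = allFin n} p∈))))

    -- By properness, c(g u, ·) is injective away from g u, so u blocks at most |usedColours| vertices.
    blocked-length : ∀ u → length (blocked u) ≤ length oldEdges
    blocked-length u = subst (length (blocked u) ≤_) (length-map colourOf oldEdges)
      (injection-length (c (g u)) (Unique.filter⁺ (blocked? u) (Unique.allFin⁺ N)) colour-injective
        (λ y∈ → proj₂ (blocked-by y∈)))
      where
      blocked-by : ∀ {y} → y ∈ blocked u → Blocked u y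
      blocked-by y∈ = proj₂ (∈-filter⁻ (blocked? u) {xs = allFin N} y∈)

      colour-injective : ∀ {y z} → y ∈ blocked u → z ∈ blocked u → c (g u) y ≡ c (g u) z → y ≡ z
      colour-injective {y} {z} y∈ z∈ same with y ≟ z
      ... | yes y≡z = y≡z
      ... | no  y≢z = ⊥-elim (distinct-at (g u) y z (≢-sym (proj₁ (blocked-by y∈)))
                                (≢-sym (proj₁ (blocked-by z∈))) y≢z same)

    forbidden-length : length forbidden ≤ i + length back * length oldEdges
    forbidden-length = begin
      length forbidden                                        ≡⟨ length-++ (map g placed) ⟩
      length (map g placed) + length (concatMap blocked back) ≤⟨ +-mono-≤ placed-images (length-concatMap-≤ blocked back blocked-length) ⟩
      i + length back * length oldEdges                       ∎
      where
      open ≤-Reasoning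
      placed-images : length (map g placed) ≤ i
      placed-images = ≤-trans (≤-reflexive (length-map g placed)) placed-length

    -- The old edges and the new edges u P are distinct increasing edges of G.
    edges-length : length oldEdges + length back ≤ e
    edges-length = subst (_≤ e) (trans (length-++ oldEdges) (cong (length oldEdges +_) (length-map (_, P) back)))
      (edge-bound (oldEdges ++ map (_, P) back) unique increasing)
      where
      old-edge : ∀ {pq} → pq ∈ oldEdges → OldEdge pq
      old-edge pq∈ = proj₂ (∈-filter⁻ old-edge? {xs = cartesianProduct (allFin n) (allFin n)} pq∈)

      disjoint : Disjoint oldEdges (map (_, P) back)
      disjoint (old , new) with ∈-map⁻ (_, P) new
      ... | _ , _ , refl = <-irrefl toℕ-P (proj₂ (old-edge old))

      unique : Unique (oldEdges ++ map (_, P) back)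
      unique = Unique.++⁺
        (Unique.filter⁺ old-edge? (Unique.cartesianProduct⁺ (Unique.allFin⁺ n) (Unique.allFin⁺ n)))
        (Unique.map⁺ (cong proj₁) (Unique.filter⁺ (T? ∘ isBack) (Unique.allFin⁺ n)))
        disjoint

      increasing : ∀ {pq} → pq ∈ oldEdges ++ map (_, P) back → IncreasingEdge G pq
      increasing pq∈ with ∈-++⁻ oldEdges pq∈
      ... | inj₁ old = proj₁ (old-edge old)
      ... | inj₂ new with ∈-map⁻ (_, P) new
      ...   | _ , u∈ , refl = back-edge u∈

    forbidden-short : length forbidden < N
    forbidden-short = ≤-<-trans forbidden-length (budget i<n (degenerate P) edges-length)

    x : Fin N
    x = proj₁ (fresh forbidden forbidden-short)

    x-unused : ∀ {p} → toℕ p < i → x ≢ g p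
    x-unused p<i x≡gp = proj₂ (fresh forbidden forbidden-short)
      (∈-++⁺ˡ (subst (_∈ map g placed) (sym x≡gp) (∈-map⁺ g (∈-filter⁺ _ (∈-allFin _) p<i))))

    x-new-colour : ∀ {u} → IncreasingEdge G (u , P) → c (g u) x ∉ usedColours
    x-new-colour uP@(u<P , _) used = proj₂ (fresh forbidden forbidden-short)
      (∈-++⁺ʳ (map g placed) (∈-concatMap⁺ blocked (Any.map (λ { refl → x-blocked }) (∈-back uP))))
      where
      x-blocked : x ∈ blocked _
      x-blocked = ∈-filter⁺ (blocked? _) (∈-allFin x) (x-unused (before-P u<P) , used)

    g⁺ : Fin n → Fin N
    g⁺ p with p ≟ P
    ... | yes _ = x
    ... | no  _ = g p

    g⁺-P : g⁺ P ≡ x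
    g⁺-P with P ≟ P
    ... | yes _   = refl
    ... | no  P≢P = ⊥-elim (P≢P refl)

    g⁺-placed : ∀ {p} → toℕ p < i → g⁺ p ≡ g p
    g⁺-placed {p} p<i with p ≟ P
    ... | yes refl = ⊥-elim (<-irrefl toℕ-P p<i)
    ... | no  _    = refl

    injective⁺ : ∀ {p q} → toℕ p < suc i → toℕ q < suc i → g⁺ p ≡ g⁺ q → p ≡ q
    injective⁺ p≤i q≤i same with placed-or-P p≤i | placed-or-P q≤i
    ... | inj₁ p<i  | inj₁ q<i  = injective p<i q<i (trans (sym (g⁺-placed p<i)) (trans same (g⁺-placed q<i)))
    ... | inj₁ p<i  | inj₂ refl = ⊥-elim (x-unused p<i (trans (sym g⁺-P) (trans (sym same) (g⁺-placed p<i))))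
    ... | inj₂ refl | inj₁ q<i  = ⊥-elim (x-unused q<i (trans (sym g⁺-P) (trans same (g⁺-placed q<i))))
    ... | inj₂ refl | inj₂ refl = refl

    colour-old : ∀ {p q} → toℕ q < i → IncreasingEdge G (p , q) → c (g⁺ p) (g⁺ q) ≡ c (g p) (g q)
    colour-old q<i (p<q , _) = cong₂ c (g⁺-placed (<-trans p<q q<i)) (g⁺-placed q<i)

    colour-new : ∀ {p} → IncreasingEdge G (p , P) → c (g⁺ p) (g⁺ P) ≡ c (g p) x
    colour-new (p<P , _) = cong₂ c (g⁺-placed (before-P p<P)) g⁺-P

    -- Distinct new edges meet at x, so properness gives them distinct colours.
    new-colours-distinct : ∀ {p p'} → IncreasingEdge G (p , P) → IncreasingEdge G (p' , P) →
      c (g p) x ≡ c (g p') x → p ≡ p'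
    new-colours-distinct {p} {p'} (p<P , _) (p'<P , _) same with g p ≟ g p'
    ... | yes gp≡gp' = injective (before-P p<P) (before-P p'<P) gp≡gp'
    ... | no  gp≢gp' = ⊥-elim (distinct-at x (g p) (g p') x≢gp x≢gp' gp≢gp' (begin
          c x (g p)  ≡⟨ symmetric x (g p) x≢gp ⟩
          c (g p) x  ≡⟨ same ⟩
          c (g p') x ≡⟨ symmetric (g p') x (≢-sym x≢gp') ⟩
          c x (g p') ∎))
      where
      open ≡-Reasoning
      x≢gp  = x-unused (before-P p<P)
      x≢gp' = x-unused (before-P p'<P)

    -- Old edges keep their distinct colours, new edges get unused colours.
    rainbow⁺ : ∀ {p q p' q'} → toℕ q < suc i → toℕ q' < suc i →
      IncreasingEdge G (p , q) → IncreasingEdge G (p' , q') →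
      c (g⁺ p) (g⁺ q) ≡ c (g⁺ p') (g⁺ q') → p ≡ p' × q ≡ q'
    rainbow⁺ q≤i q'≤i pq p'q' same with placed-or-P q≤i | placed-or-P q'≤i
    ... | inj₁ q<i  | inj₁ q'<i =
      rainbow q<i q'<i pq p'q' (trans (sym (colour-old q<i pq)) (trans same (colour-old q'<i p'q')))
    ... | inj₁ q<i  | inj₂ refl = ⊥-elim (x-new-colour p'q'
      (subst (_∈ usedColours) (trans (sym (colour-old q<i pq)) (trans same (colour-new p'q'))) (old-colour-used q<i pq)))
    ... | inj₂ refl | inj₁ q'<i = ⊥-elim (x-new-colour pq
      (subst (_∈ usedColours) (trans (sym (colour-old q'<i p'q')) (trans (sym same) (colour-new pq))) (old-colour-used q'<i p'q')))
    ... | inj₂ refl | inj₂ refl =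
      new-colours-distinct pq p'q' (trans (sym (colour-new pq)) (trans same (colour-new p'q'))) , refl

    extended : PartialRainbow (suc i)
    extended = record { embed = g⁺ ; injective = injective⁺ ; rainbow = rainbow⁺ }

  stage : ∀ i → i ≤ n → PartialRainbow i
  stage zero    _   = start
  stage (suc i) i<n = Extend.extended i<n (stage i (≤-trans (n≤1+n i) i<n))

  rainbow-copy : RainbowCopy G N c
  rainbow-copy = complete (stage n ≤-refl)

-- The forward map of a permutation is injective; applied to the inverse
-- permutation this also covers the backward map.
permutation-injective : ∀ {m} (σ : Permutation′ m) → Injective _≡_ _≡_ (σ ⟨$⟩ʳ_)
permutation-injective σ same = trans (sym (inverseˡ σ)) (trans (cong (σ ⟨$⟩ˡ_) same) (inverseˡ σ))

unrelabel : (H : Graph) (σ : Permutation′ (v H)) {N : ℕ} {c : Fin N → Fin N → ℕ} →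
  RainbowCopy (induced H (σ ⟨$⟩ʳ_)) N c → RainbowCopy H N c
unrelabel H σ {c = c} (f , f-inj , f-rainbow) = f ∘ (σ ⟨$⟩ˡ_) , σ⁻¹-inj ∘ f-inj , rainbow
  where
  σ⁻¹-inj : Injective _≡_ _≡_ (σ ⟨$⟩ˡ_)
  σ⁻¹-inj = permutation-injective (flip σ)

  pull : ∀ {a b} → T (adj H a b) → T (adj H (σ ⟨$⟩ʳ (σ ⟨$⟩ˡ a)) (σ ⟨$⟩ʳ (σ ⟨$⟩ˡ b)))
  pull = subst₂ (λ a b → T (adj H a b)) (sym (inverseʳ σ)) (sym (inverseʳ σ))

  rainbow : ∀ a b a' b' → T (adj H a b) → T (adj H a' b') →
    c (f (σ ⟨$⟩ˡ a)) (f (σ ⟨$⟩ˡ b)) ≡ c (f (σ ⟨$⟩ˡ a')) (f (σ ⟨$⟩ˡ b')) → SameEdge a b a' b'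
  rainbow a b a' b' ab a'b' same = same-edge-injective σ⁻¹-inj (f-rainbow _ _ _ _ (pull ab) (pull a'b') same)

theorem1p1 : (H : Graph) (k : ℕ) → IsDegeneracy H k →
    ARle H (k * eH H ∸ k + vH H)
theorem1p1 H k ((σ , degenerate) , _) = k * eH H ∸ k + vH H , ≤-refl , rainbow-forcing
  where
  relabelled : Graph
  relabelled = induced H (σ ⟨$⟩ʳ_)

  edge-bound : EdgeBound relabelled (eH H)
  edge-bound = induced-edge-bound H (σ ⟨$⟩ʳ_) (permutation-injective σ)

  rainbow-forcing : RainbowForcing H (k * eH H ∸ k + vH H)
  rainbow-forcing c proper =
    unrelabel H σ {c = c} (Greedy.rainbow-copy relabelled k (eH H) degenerate edge-bound c proper)
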